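{- The set $\mathcal{S}$ is infinite.
   Context: For an integer base $g\ge2$ and integer $m\ge0$, $s_g(m)$ denotes the sum of base-$g$ digits of $m$. A positive integer $m$ has a strict $s$-decomposition if $m=\prod_{\nu=1}^n g_\nu^{e_\nu}$ with exponents $e_\nu\ge1$ and proper factors $1<g_\nu<m$, strictly increasing $g_1<\dots<g_n$ (not necessarily coprime), with $s_{g_\nu}(m)=g_\nu$ for each $\nu$; $\mathcal{S}$ is the set of positive integers having a strict $s$-decomposition. -}

module Defs where

open import Data.Nat using (ℕ; zero; suc; _+_; _*_; _^_; _<_; _≤_; NonZero)
open import Data.Nat.DivMod using (_/_; _%_)
open import Data.List using (List; []; _∷_; map)
open import Data.Nat.ListAction using (product)
open import Data.List.Relation.Unary.All using (All)
open import Data.List.Relation.Unary.Linked using (Linked)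
open import Data.Product using (_×_; _,_; proj₁; proj₂; ∃-syntax)
open import Relation.Binary.PropositionalEquality using (_≡_; _≢_)

-- Sum of base-(2+k) digits of m, computed with a fuel argument.
-- With fuel ≥ m the result is exact, since each step divides by ≥ 2.
digitSumFuel : ℕ → (k : ℕ) → ℕ → ℕ
digitSumFuel zero    k m = 0
digitSumFuel (suc f) k zero = 0
digitSumFuel (suc f) k m@(suc _) =
  m % suc (suc k) + digitSumFuel f k (m / suc (suc k))

-- s_g(m) for a base g ≥ 2 (for g < 2 the value is irrelevant and unused;
-- we return 0 there).
s : (g m : ℕ) → ℕ
s zero          m = 0
s (suc zero)    m = 0
s (suc (suc k)) m = digitSumFuel m k m

StrictSDecomposition : ℕ → List (ℕ × ℕ) → Set
StrictSDecomposition m ges =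
  (ges ≢ [])
  × (product (map (λ ge → proj₁ ge ^ proj₂ ge) ges) ≡ m)
  × All (λ ge → (1 ≤ proj₂ ge) × (1 < proj₁ ge) × (proj₁ ge < m)
                × (s (proj₁ ge) m ≡ proj₁ ge)) ges
  × Linked (λ a b → proj₁ a < proj₁ b) ges

InS : ℕ → Set
InS m = (1 ≤ m) × ∃[ ges ] StrictSDecomposition m ges

{-# OPTIONS --safe #-}
-- Take g = 2N + 3 and h = 4N + 5 = 2g − 1. Then m = g²h = g³ + (g − 1)g² has base-g
-- digits 1, g − 1, 0, 0, and since 4g² = (h + 1)², it has base-h digits N + 1, 3N + 4, 0.
-- Hence s_g(m) = g and s_h(m) = h, so m = g² h is a strict s-decomposition, and m ≥ N.
module Submission where

open import Defs
open import Data.Nat using (ℕ; zero; suc; _+_; _*_; _^_; _≤_; _<_; z≤n; s≤s; NonZero)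
open import Data.Nat.Properties
open import Data.Nat.DivMod
open import Data.Nat.Divisibility using (n∣m*n)
open import Data.Nat.ListAction using (sum)
open import Data.List using (List; []; _∷_)
open import Data.List.Relation.Unary.All using (All; []; _∷_)
open import Data.List.Relation.Unary.Linked using ([-]; _∷_)
open import Data.Product using (_×_; _,_; ∃-syntax)
open import Relation.Binary.PropositionalEquality
open import Data.Nat.Tactic.RingSolver using (solve-∀)

fromDigits : ℕ → List ℕ → ℕ
fromDigits b []       = 0
fromDigits b (d ∷ ds) = d + fromDigits b ds * b

[m+kn]%n≡m : ∀ {m n} k .{{_ : NonZero n}} → m < n → (m + k * n) % n ≡ m
[m+kn]%n≡m {m} {n} k m<n = trans ([m+kn]%n≡m%n m k n) (m<n⇒m%n≡m m<n)

[m+kn]/n≡k : ∀ {m n} k .{{_ : NonZero n}} → m < n → (m + k * n) / n ≡ k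
[m+kn]/n≡k {m} {n} k m<n = begin
  (m + k * n) / n  ≡⟨ +-distrib-/-∣ʳ m (n∣m*n k) ⟩
  m / n + k * n / n ≡⟨ cong₂ _+_ (m<n⇒m/n≡0 m<n) (m*n/n≡m k n) ⟩
  k                ∎
  where open ≡-Reasoning

digitSumFuel-0 : ∀ f k → digitSumFuel f k 0 ≡ 0
digitSumFuel-0 zero    k = refl
digitSumFuel-0 (suc f) k = refl

digitSumFuel-suc : ∀ f k m →
  digitSumFuel (suc f) k m ≡ m % suc (suc k) + digitSumFuel f k (m / suc (suc k))
digitSumFuel-suc f k zero    = sym (digitSumFuel-0 f k)
digitSumFuel-suc f k (suc m) = refl

fromDigits≡0⇒sum≡0 : ∀ k ds → fromDigits (2 + k) ds ≡ 0 → sum ds ≡ 0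
fromDigits≡0⇒sum≡0 k []       _  = refl
fromDigits≡0⇒sum≡0 k (d ∷ ds) eq =
  cong₂ _+_ (m+n≡0⇒m≡0 d eq)
    (fromDigits≡0⇒sum≡0 k ds (m*n≡0⇒m≡0 _ (2 + k) (m+n≡0⇒n≡0 d eq)))

m+kn≤1+o⇒k≤o : ∀ {k n o} m → 1 < n → m + k * n ≤ suc o → k ≤ o
m+kn≤1+o⇒k≤o {zero}      m 1<n le = z≤n
m+kn≤1+o⇒k≤o {suc k} {n} m 1<n le =
  ≤-pred (≤-trans (m<m*n (suc k) n 1<n) (≤-trans (m≤n+m (suc k * n) m) le))

digitSumFuel-fromDigits : ∀ k {ds} f → All (_< 2 + k) ds →
  fromDigits (2 + k) ds ≤ f → digitSumFuel f k (fromDigits (2 + k) ds) ≡ sum ds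
digitSumFuel-fromDigits k f [] _ = digitSumFuel-0 f k
digitSumFuel-fromDigits k {ds = d ∷ ds} zero (_ ∷ _) v≤0 =
  sym (fromDigits≡0⇒sum≡0 k (d ∷ ds) (n≤0⇒n≡0 v≤0))
digitSumFuel-fromDigits k {ds = d ∷ ds} (suc f) (d<b ∷ ds<b) v≤f = begin
  digitSumFuel (suc f) k v               ≡⟨ digitSumFuel-suc f k v ⟩
  v % b + digitSumFuel f k (v / b)       ≡⟨ cong₂ _+_ ([m+kn]%n≡m q d<b)
                                              (cong (digitSumFuel f k) ([m+kn]/n≡k q d<b)) ⟩
  d + digitSumFuel f k q                 ≡⟨ cong (d +_) (digitSumFuel-fromDigits k f ds<b
                                              (m+kn≤1+o⇒k≤o d (s≤s (s≤s z≤n)) v≤f)) ⟩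
  d + sum ds                             ∎
  where
  open ≡-Reasoning
  b = 2 + k
  q = fromDigits b ds
  v = d + q * b

s-fromDigits : ∀ k {ds} → All (_< 2 + k) ds → s (2 + k) (fromDigits (2 + k) ds) ≡ sum ds
s-fromDigits k ds<b = digitSumFuel-fromDigits k _ ds<b ≤-refl

inS-twoBases : ∀ {g h a b m} → 1 < g → g < h → h < m → 1 ≤ a → 1 ≤ b →
  s g m ≡ g → s h m ≡ h → g ^ a * h ^ b ≡ m → InS m
inS-twoBases {g} {h} {a} {b} 1<g g<h h<m 1≤a 1≤b sg sh eq =
  ≤-trans (s≤s z≤n) h<m
  , ((g , a) ∷ (h , b) ∷ [])
  , (λ ())
  , trans (cong (g ^ a *_) (*-identityʳ (h ^ b))) eq
  , ((1≤a , 1<g , <-trans g<h h<m , sg) ∷ (1≤b , <-trans 1<g g<h , h<m , sh) ∷ [])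
  , (g<h ∷ [-])

-- Both sides are written with ^, fromDigits and sum unfolded as they are used below,
-- since solve-∀ does not unfold definitions.
g²h-horner-g : ∀ n → (3 + 2 * n) * ((3 + 2 * n) * 1) * (5 + 4 * n)
                   ≡ (2 + 2 * n + 1 * (3 + 2 * n)) * (3 + 2 * n) * (3 + 2 * n)
g²h-horner-g = solve-∀

g²h-horner-h : ∀ n → (3 + 2 * n) * ((3 + 2 * n) * 1) * (5 + 4 * n)
                   ≡ (4 + 3 * n + (1 + n + 0) * (5 + 4 * n)) * (5 + 4 * n)
g²h-horner-h = solve-∀

digits-g-total : ∀ n → 2 + 2 * n + 1 ≡ 3 + 2 * n
digits-g-total = solve-∀

digits-h-total : ∀ n → 4 + 3 * n + (1 + n + 0) ≡ 5 + 4 * n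
digits-h-total = solve-∀

module Witness (N : ℕ) where
  g h : ℕ
  g = 3 + 2 * N
  h = 5 + 4 * N

  s-g : s g (g ^ 2 * h) ≡ g
  s-g = begin
    s g (g ^ 2 * h)                                   ≡⟨ cong (s g) (g²h-horner-g N) ⟩
    s g (fromDigits g (0 ∷ 0 ∷ (2 + 2 * N) ∷ 1 ∷ [])) ≡⟨ s-fromDigits (1 + 2 * N)
         (s≤s z≤n ∷ s≤s z≤n ∷ ≤-refl ∷ s≤s (s≤s z≤n) ∷ []) ⟩
    sum (0 ∷ 0 ∷ (2 + 2 * N) ∷ 1 ∷ [])                ≡⟨ digits-g-total N ⟩
    g                                                 ∎
    where open ≡-Reasoning

  s-h : s h (g ^ 2 * h) ≡ h
  s-h = begin
    s h (g ^ 2 * h)                                     ≡⟨ cong (s h) (g²h-horner-h N) ⟩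
    s h (fromDigits h (0 ∷ (4 + 3 * N) ∷ (1 + N) ∷ [])) ≡⟨ s-fromDigits (3 + 4 * N)
         (s≤s z≤n ∷ 4+3N<h ∷ 1+N<h ∷ []) ⟩
    sum (0 ∷ (4 + 3 * N) ∷ (1 + N) ∷ [])                ≡⟨ digits-h-total N ⟩
    h                                                   ∎
    where
    open ≡-Reasoning
    4+3N<h : 4 + 3 * N < h
    4+3N<h = +-monoʳ-≤ 5 (*-monoˡ-≤ N (n≤1+n 3))
    1+N<h : 1 + N < h
    1+N<h = s≤s (s≤s (≤-trans (m≤m+n N (3 * N)) (m≤n+m (4 * N) 3)))

  g<h : g < h
  g<h = m≤n⇒m≤1+n (+-monoʳ-≤ 4 (*-monoˡ-≤ N {2} {4} (s≤s (s≤s z≤n))))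

  h<g²h : h < g ^ 2 * h
  h<g²h = subst (h <_) (*-comm h (g ^ 2)) (m<m*n h (g ^ 2) (s≤s (s≤s z≤n)))

  N≤h : N ≤ h
  N≤h = ≤-trans (m≤m+n N (3 * N)) (m≤n+m (4 * N) 5)

theorem2p5 : ∀ (N : ℕ) → ∃[ m ] (N ≤ m × InS m)
theorem2p5 N =
  g ^ 2 * h
  , ≤-trans N≤h (<⇒≤ h<g²h)
  , inS-twoBases {a = 2} {b = 1} (s≤s (s≤s z≤n)) g<h h<g²h (s≤s z≤n) ≤-refl
      s-g s-h (cong (g ^ 2 *_) (*-identityʳ h))
  where open Witness N
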